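{- Let $\Omega=(S,\Sigma,\Pi)$ be a many-sorted signature, $\mathcal{S}$ a theory over $\Omega$ with initial model $\mathcal{I}$, and $\varphi$ a sentence of the form $(Q_1 x_1:s_1)\cdots(Q_k x_k:s_k)\bigvee_{i=1}^m\bigwedge_{j=1}^{n_i} L_{ij}$. Let $\psi$ be the Skolem normal form of $\neg\varphi$ over the extended signature $\Omega^{sk}$, and let $\mathcal{A}$ be an $\Omega^{sk}$-structure with $\mathcal{A}\models\psi$, whose $\Omega$-reduct is a model of $\mathcal{S}$ (with unique homomorphism $h:\mathcal{I}\to\mathcal{A}$), such that for every $q\in U_\exists\cup E$ every element of $\mathcal{A}_{s_q}$ is the value of some ground $\Omega$-term of sort $s_q$, and such that for every negative literal $L_{ij}=\neg P(t_1,\ldots,t_n)$ of $\varphi$ with $P\in\Pi_w$ and every substitution $\sigma$ of ground terms for variables, if $h(\sigma(t_1),\ldots,\sigma(t_n))\in P^{\mathcal{A}}$ then $(\sigma(t_1),\ldots,\sigma(t_n))\in P^{\mathcal{I}}$. Let $\Phi$ be any set of refutation witnesses for $\psi$ built from $\mathcal{A}$. Then $\mathcal{I}\models\phi$ for every $\phi\in\Phi$.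
   Context: Many-sorted first-order logic with the usual structures and homomorphisms (identity predicate interpreted as identity). The initial model $\mathcal{I}$ of a theory $\mathcal{S}$ is the initial model of the set of ground atoms derivable from $\mathcal{S}$: carriers are ground terms modulo the least congruence generated by derivable ground equations, functions interpreted syntactically, and $P^{\mathcal{I}}$ the classes of tuples $(t_1,\ldots,t_n)$ with $\mathcal{S}\vdash P(t_1,\ldots,t_n)$; $h$ sends the class of a ground term to its value in $\mathcal{A}$. In $\varphi$, the $L_{ij}$ are literals (atoms or negated atoms), $x_1,\ldots,x_k$ the distinct variables occurring in them, of sorts $s_1,\ldots,s_k$, $Q_q\in\{\forall,\exists\}$. The negation of $\varphi$ is written $(\overline{Q}_1 x_1:s_1)\cdots(\overline{Q}_k x_k:s_k)\bigwedge_i\bigvee_j\neg L_{ij}$ with $\overline{\forall}=\exists$, $\overline{\exists}=\forall$ ($\neg\neg A$ identified with $A$). Let $U=\{q:\overline{Q}_q=\forall\}$, $E=\{1,\ldots,k\}\setminus U$, $U_\epsilon=\{\upsilon\in U:\upsilon<\epsilon\}$ for $\epsilon\in E$, $w_\epsilon$ the sorts $s_\upsilon$, $\upsilon\in U_\epsilon$, in increasing order, $U_\exists=\bigcup_{\epsilon\in E}U_\epsilon$, $U_\forall=U\setminus U_\exists$. $\Omega^{sk}$ adds fresh Skolem symbols $sk_\epsilon:w_\epsilon\to s_\epsilon$, $\epsilon\in E$. The Skolem normal form is $\psi=(\forall x_\upsilon:s_\upsilon)_{\upsilon\in U}\bigwedge_i\bigvee_j\neg L_{ij}(e_1,\ldots,e_k)$,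 where $(e_1,\ldots,e_k)$ indicates replacing each $x_q$ by $e_q$, with $e_q=x_q$ for $q\in U$ and $e_q=sk_q(x_\upsilon)_{\upsilon\in U_q}$ for $q\in E$. A set of refutation witnesses $\Phi$ built from $\mathcal{A}$ contains, for each valuation $\alpha$ of the variables $x_q$, $q\in U_\exists$, in $\mathcal{A}$, one $\Omega$-sentence $\phi_\alpha=(\forall x_q:s_q)_{q\in U_\forall}\bigwedge_i\bigvee_j\neg L_{ij}(e'_1,\ldots,e'_k)$ with $e'_q=x_q$ for $q\in U_\forall$ and, for $q\in U_\exists\cup E$, $e'_q$ some ground $\Omega$-term of sort $s_q$ whose value in $\mathcal{A}$ equals the value of $e_q$ under $\alpha$. -}

module Defs where

open import Level using (Level; 0ℓ; _⊔_; Lift; lift) renaming (suc to lsuc)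
open import Data.List using (List; []; _∷_; map)
open import Data.List.Relation.Unary.All using (All)
open import Data.List.Relation.Unary.Any using (Any)
open import Data.List.Membership.Propositional using (_∈_)
open import Data.Product using (Σ; _×_; _,_; proj₁; proj₂)
open import Data.Sum using (_⊎_; inj₁; inj₂)
open import Data.Unit using (⊤; tt)
open import Data.Empty using (⊥; ⊥-elim)
open import Data.Bool using (Bool; true; false; T; not; _∧_; _∨_)
open import Data.Fin using (Fin; zero; suc; toℕ)
open import Data.Nat using (ℕ; zero; suc; _<ᵇ_)
open import Relation.Binary using (Setoid)
open import Relation.Binary.PropositionalEquality using (_≡_; refl)
open import Relation.Nullary using (¬_)

record Signature : Set₁ where
  field
    Sort : Set
    Fun  : List Sort → Sort → Set
    Pred : List Sort → Set             -- Π_w   (the identity predicate is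
                                       -- built in, see _≐_ below)
open Signature public

withFun : (Ω : Signature) → (List (Sort Ω) → Sort Ω → Set) → Signature
withFun Ω F = record { Sort = Sort Ω ; Fun = F ; Pred = Pred Ω }

module _ (Ω : Signature) where
  mutual
    data Term (V : Sort Ω → Set) : Sort Ω → Set where
      var : ∀ {s} → V s → Term V s
      app : ∀ {ws s} → Fun Ω ws s → Terms V ws → Term V s

    data Terms (V : Sort Ω → Set) : List (Sort Ω) → Set where
      []  : Terms V []
      _∷_ : ∀ {s ws} → Term V s → Terms V ws → Terms V (s ∷ ws)

  data Atom (V : Sort Ω → Set) : Set where
    pr  : ∀ {ws} → Pred Ω ws → Terms V ws → Atom V
    _≐_ : ∀ {s} → Term V s → Term V s → Atom V

  data Literal (V : Sort Ω → Set) : Set where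
    pos : Atom V → Literal V
    neg : Atom V → Literal V

  data _∋_ : List (Sort Ω) → Sort Ω → Set where
    here  : ∀ {s Γ} → (s ∷ Γ) ∋ s
    there : ∀ {s t Γ} → Γ ∋ s → (t ∷ Γ) ∋ s

  Var : List (Sort Ω) → Sort Ω → Set
  Var Γ s = Γ ∋ s

  data Formula (Γ : List (Sort Ω)) : Set where
    ⊤' ⊥'      : Formula Γ
    atom       : Atom (Var Γ) → Formula Γ
    ¬'_        : Formula Γ → Formula Γ
    _∧'_ _∨'_ _⇒'_ : Formula Γ → Formula Γ → Formula Γ
    ∀' ∃'      : (s : Sort Ω) → Formula (s ∷ Γ) → Formula Γ

  Sentence : Set
  Sentence = Formula []

  Theory : Set₁
  Theory = Sentence → Set

Ø : {S : Set} → S → Set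
Ø _ = ⊥

GTerm : (Ω : Signature) → Sort Ω → Set
GTerm Ω s = Term Ω Ø s

module _ {Ω : Signature} {F : List (Sort Ω) → Sort Ω → Set}
         (tr : ∀ {ws s} → Fun Ω ws s → F ws s)
         {V V' : Sort Ω → Set}
         (σ : ∀ {s} → V s → Term (withFun Ω F) V' s) where
  mutual
    trSubst : ∀ {s} → Term Ω V s → Term (withFun Ω F) V' s
    trSubst (var x)    = σ x
    trSubst (app f ts) = app (tr f) (trSubsts ts)

    trSubsts : ∀ {ws} → Terms Ω V ws → Terms (withFun Ω F) V' ws
    trSubsts []       = []
    trSubsts (t ∷ ts) = trSubst t ∷ trSubsts ts

  trSubstA : Atom Ω V → Atom (withFun Ω F) V'
  trSubstA (pr P ts) = pr P (trSubsts ts)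
  trSubstA (t ≐ u)    = trSubst t ≐ trSubst u

  trSubstL : Literal Ω V → Literal (withFun Ω F) V'
  trSubstL (pos a) = pos (trSubstA a)
  trSubstL (neg a) = neg (trSubstA a)

substA : {Ω : Signature} {V V' : Sort Ω → Set} →
         (∀ {s} → V s → Term Ω V' s) → Atom Ω V → Atom Ω V'
substA {Ω} σ = trSubstA {Ω} {Fun Ω} (λ f → f) σ

substL : {Ω : Signature} {V V' : Sort Ω → Set} →
         (∀ {s} → V s → Term Ω V' s) → Literal Ω V → Literal Ω V'
substL {Ω} σ = trSubstL {Ω} {Fun Ω} (λ f → f) σ

weaken : {Ω : Signature} {V : Sort Ω → Set} {s : Sort Ω} → GTerm Ω s → Term Ω V s
weaken {Ω} = trSubst {Ω} {Fun Ω} (λ f → f) (λ ())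

negLit : {Ω : Signature} {V : Sort Ω → Set} → Literal Ω V → Literal Ω V
negLit (pos a) = neg a
negLit (neg a) = pos a

-- Structures (carriers are setoids; the identity predicate is interpreted
-- as the setoid equality, i.e. as identity of the underlying quotient)

data Args {c ℓ : Level} {S : Set} (C : S → Setoid c ℓ) : List S → Set c where
  []  : Args C []
  _∷_ : ∀ {s ws} → Setoid.Carrier (C s) → Args C ws → Args C (s ∷ ws)

data Args≈ {c ℓ : Level} {S : Set} (C : S → Setoid c ℓ) :
           ∀ {ws} → Args C ws → Args C ws → Set (c ⊔ ℓ) where
  []  : Args≈ C [] []
  _∷_ : ∀ {s ws} {x y : Setoid.Carrier (C s)} {xs ys : Args C ws} →
        Setoid._≈_ (C s) x y → Args≈ C xs ys → Args≈ C (x ∷ xs) (y ∷ ys)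

record Structure (Ω : Signature) (c ℓ : Level) : Set (lsuc (c ⊔ ℓ)) where
  field
    Car      : Sort Ω → Setoid c ℓ
    fun      : ∀ {ws s} → Fun Ω ws s → Args Car ws → Setoid.Carrier (Car s)
    fun-cong : ∀ {ws s} (f : Fun Ω ws s) {xs ys : Args Car ws} →
               Args≈ Car xs ys → Setoid._≈_ (Car s) (fun f xs) (fun f ys)
    rel      : ∀ {ws} → Pred Ω ws → Args Car ws → Set ℓ
    rel-resp : ∀ {ws} (P : Pred Ω ws) {xs ys : Args Car ws} →
               Args≈ Car xs ys → rel P xs → rel P ys

  Carrier : Sort Ω → Set c
  Carrier s = Setoid.Carrier (Car s)

  _≈⟨_⟩_ : ∀ {s'} → Carrier s' → (s : Sort Ω) → Carrier s' → Set ℓ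
  _≈⟨_⟩_ {s'} x _ y = Setoid._≈_ (Car s') x y
open Structure public

module _ {Ω : Signature} {c ℓ : Level} (M : Structure Ω c ℓ) where

  Env : (Sort Ω → Set) → Set c
  Env V = ∀ {s} → V s → Carrier M s

  emptyEnv : Env Ø
  emptyEnv ()

  mutual
    eval : ∀ {V s} → Term Ω V s → Env V → Carrier M s
    eval (var x)    ρ = ρ x
    eval (app f ts) ρ = fun M f (evals ts ρ)

    evals : ∀ {V ws} → Terms Ω V ws → Env V → Args (Car M) ws
    evals []       ρ = []
    evals (t ∷ ts) ρ = eval t ρ ∷ evals ts ρ

  satA : ∀ {V} → Atom Ω V → Env V → Set ℓ
  satA (pr P ts) ρ = rel M P (evals ts ρ)
  satA (_≐_ {s} t u) ρ = Setoid._≈_ (Car M s) (eval t ρ) (eval u ρ)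

  satL : ∀ {V} → Literal Ω V → Env V → Set ℓ
  satL (pos a) ρ = satA a ρ
  satL (neg a) ρ = ¬ satA a ρ

  _▸_ : ∀ {Γ s} → Env (Var Ω Γ) → Carrier M s → Env (Var Ω (s ∷ Γ))
  (ρ ▸ x) here      = x
  (ρ ▸ x) (there v) = ρ v

  sat : ∀ {Γ} → Formula Ω Γ → Env (Var Ω Γ) → Set (c ⊔ ℓ)
  sat ⊤'          ρ = Lift (c ⊔ ℓ) ⊤
  sat ⊥'          ρ = Lift (c ⊔ ℓ) ⊥
  sat (atom a)    ρ = Lift c (satA a ρ)
  sat (¬' φ)      ρ = ¬ sat φ ρ
  sat (φ ∧' ψ)    ρ = sat φ ρ × sat ψ ρ
  sat (φ ∨' ψ)    ρ = sat φ ρ ⊎ sat ψ ρ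
  sat (φ ⇒' ψ)    ρ = sat φ ρ → sat ψ ρ
  sat (∀' s φ)    ρ = (x : Carrier M s) → sat φ (ρ ▸ x)
  sat (∃' s φ)    ρ = Σ (Carrier M s) λ x → sat φ (ρ ▸ x)

  noEnv : Env (Var Ω [])
  noEnv ()

  IsModel : Theory Ω → Set (c ⊔ ℓ)
  IsModel 𝒮 = ∀ φ → 𝒮 φ → sat φ noEnv

  satGA : Atom Ω Ø → Set ℓ
  satGA a = satA a emptyEnv

  -- value of a ground term (this is the unique homomorphism h : 𝓘 → M,
  -- on representatives)
  h : ∀ {s} → GTerm Ω s → Carrier M s
  h t = eval t emptyEnv

  SatUnivCNF : ∀ {V} → List (List (Literal Ω V)) → Set (c ⊔ ℓ)
  SatUnivCNF {V} mat = (ρ : Env V) → All (λ cl → Any (λ L → satL L ρ) cl) mat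

-- Derivable ground atoms and the initial model 𝓘 of a theory 𝒮
-- (derivability 𝒮 ⊢ A is taken semantically: A holds in every model of
--  𝒮; by soundness and completeness this is derivability)

module Initial {Ω : Signature} (𝒮 : Theory Ω) where

  Derives : Atom Ω Ø → Set₁
  Derives a = (M : Structure Ω 0ℓ 0ℓ) → IsModel M 𝒮 → satGA M a

  termSetoid : Sort Ω → Setoid 0ℓ (lsuc 0ℓ)
  termSetoid s = record
    { Carrier = GTerm Ω s
    ; _≈_ = λ t u → Derives (t ≐ u)
    ; isEquivalence = record
      { refl  = λ M m → Setoid.refl (Car M s)
      ; sym   = λ p M m → Setoid.sym (Car M s) (p M m)
      ; trans = λ p q M m → Setoid.trans (Car M s) (p M m) (q M m)
      }
    }

  toTerms : ∀ {ws} → Args termSetoid ws → Terms Ω Ø ws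
  toTerms []       = []
  toTerms (t ∷ ts) = t ∷ toTerms ts

  evals-cong : ∀ {ws} {xs ys : Args termSetoid ws} → Args≈ termSetoid xs ys →
               (M : Structure Ω 0ℓ 0ℓ) → IsModel M 𝒮 →
               Args≈ (Car M) (evals M (toTerms xs) (emptyEnv M))
                             (evals M (toTerms ys) (emptyEnv M))
  evals-cong []       M m = []
  evals-cong (p ∷ ps) M m = p M m ∷ evals-cong ps M m

  𝓘 : Structure Ω 0ℓ (lsuc 0ℓ)
  𝓘 = record
    { Car      = termSetoid
    ; fun      = λ f ts → app f (toTerms ts)
    ; fun-cong = λ f ps M m → fun-cong M f (evals-cong ps M m)
    ; rel      = λ P ts → Derives (pr P (toTerms ts))
    ; rel-resp = λ P ps d M m → rel-resp M P (evals-cong ps M m) (d M m)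
    }

data Quant : Set where
  ∀q ∃q : Quant

dual : Quant → Quant
dual ∀q = ∃q
dual ∃q = ∀q

isAll : Quant → Bool
isAll ∀q = true
isAll ∃q = false

module _ {Ω : Signature} {V : Sort Ω → Set} where
  mutual
    data OccT (x : Σ (Sort Ω) V) : ∀ {s} → Term Ω V s → Set where
      here : OccT x (var (proj₂ x))
      arg  : ∀ {ws s} {f : Fun Ω ws s} {ts} → OccTs x ts → OccT x (app f ts)

    data OccTs (x : Σ (Sort Ω) V) : ∀ {ws} → Terms Ω V ws → Set where
      head : ∀ {s ws} {t : Term Ω V s} {ts : Terms Ω V ws} → OccT x t → OccTs x (t ∷ ts)
      tail : ∀ {s ws} {t : Term Ω V s} {ts : Terms Ω V ws} → OccTs x ts → OccTs x (t ∷ ts)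

  data OccA (x : Σ (Sort Ω) V) : Atom Ω V → Set where
    inRel : ∀ {ws} {P : Pred Ω ws} {ts} → OccTs x ts → OccA x (pr P ts)
    inLhs : ∀ {s} {t u : Term Ω V s} → OccT x t → OccA x (t ≐ u)
    inRhs : ∀ {s} {t u : Term Ω V s} → OccT x u → OccA x (t ≐ u)

  data OccL (x : Σ (Sort Ω) V) : Literal Ω V → Set where
    inPos : ∀ {a} → OccA x a → OccL x (pos a)
    inNeg : ∀ {a} → OccA x a → OccL x (neg a)

VK : {Ω : Signature} (k : ℕ) → (Fin k → Sort Ω) → Sort Ω → Set
VK {Ω} k sorts s = Σ (Fin k) λ q → sorts q ≡ s

record PrenexDNF (Ω : Signature) : Set where
  field
    k      : ℕ
    sorts  : Fin k → Sort Ω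
    Q      : Fin k → Quant
    -- ⋁_{i=1}^m ⋀_{j=1}^{n_i} L_ij  (outer list over i, inner over j)
    matrix : List (List (Literal Ω (VK {Ω} k sorts)))
    occurs : ∀ q → Any (Any (OccL (sorts q , (q , refl)))) matrix

anyFin : (n : ℕ) → (Fin n → Bool) → Bool
anyFin zero    p = false
anyFin (suc n) p = p zero ∨ anyFin n (λ i → p (suc i))

filterFin : (n : ℕ) → (p : Fin n → Bool) → List (Σ (Fin n) λ i → T (p i))
filterFin zero    p = []
filterFin (suc n) p = rest (p zero) (λ x → x)
  where
  tl = map (λ (i , t) → (suc i , t)) (filterFin n (λ i → p (suc i)))
  rest : (b : Bool) → (T b → T (p zero)) → List (Σ (Fin (suc n)) λ i → T (p i))
  rest true  e = (zero , e tt) ∷ tl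
  rest false e = tl

ifT : {a : Level} {A : Set a} (b : Bool) → (T b → A) → (T (not b) → A) → A
ifT true  f g = f tt
ifT false f g = g tt

T-∧ˡ : ∀ a b → T (a ∧ b) → T a
T-∧ˡ true b _ = tt

T-∧ʳ : ∀ a b → T (a ∧ b) → T b
T-∧ʳ true b t = t

T-∧ : ∀ a b → T a → T b → T (a ∧ b)
T-∧ true b _ t = t

anyFin-intro : ∀ n (p : Fin n → Bool) i → T (p i) → T (anyFin n p)
anyFin-intro (suc n) p zero t with p zero
... | true = tt
anyFin-intro (suc n) p (suc i) t with p zero
... | true  = tt
... | false = anyFin-intro n (λ j → p (suc j)) i t

T-∨ʳ : ∀ a b → T b → T (a ∨ b)
T-∨ʳ true  b _ = tt
T-∨ʳ false b t = t

module Skolem {Ω : Signature} (φ : PrenexDNF Ω) where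
  open PrenexDNF φ

  _<?ᵇ_ : Fin k → Fin k → Bool
  i <?ᵇ j = toℕ i <ᵇ toℕ j

  isU : Fin k → Bool
  isU q = isAll (dual (Q q))

  isE : Fin k → Bool
  isE q = not (isU q)

  -- υ ∈ U_∃ = ⋃_{ε∈E} U_ε   iff  υ ∈ U and υ < ε for some ε ∈ E
  inSomeUε : Fin k → Bool
  inSomeUε υ = anyFin k (λ ε → isE ε ∧ (υ <?ᵇ ε))

  isU∃ : Fin k → Bool
  isU∃ υ = isU υ ∧ inSomeUε υ

  isU∀ : Fin k → Bool
  isU∀ υ = isU υ ∧ not (inSomeUε υ)

  Uε : (ε : Fin k) → List (Σ (Fin k) λ υ → T (isU υ ∧ (υ <?ᵇ ε)))
  Uε ε = filterFin k (λ υ → isU υ ∧ (υ <?ᵇ ε))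

  wε : Fin k → List (Sort Ω)
  wε ε = map (λ u → sorts (proj₁ u)) (Uε ε)

  SkSym : List (Sort Ω) → Sort Ω → Set
  SkSym ws s = Σ (Fin k) λ ε → T (isE ε) × (wε ε ≡ ws) × (sorts ε ≡ s)

  SkFun : List (Sort Ω) → Sort Ω → Set
  SkFun ws s = Fun Ω ws s ⊎ SkSym ws s

  Ωsk : Signature
  Ωsk = withFun Ω SkFun

  VU VU∃ VU∀ : Sort Ω → Set
  VU  s = Σ (Fin k) λ q → T (isU q)  × (sorts q ≡ s)
  VU∃ s = Σ (Fin k) λ q → T (isU∃ q) × (sorts q ≡ s)
  VU∀ s = Σ (Fin k) λ q → T (isU∀ q) × (sorts q ≡ s)

  uvars : ∀ ε (l : List (Σ (Fin k) λ υ → T (isU υ ∧ (υ <?ᵇ ε)))) →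
          Terms Ωsk VU (map (λ u → sorts (proj₁ u)) l)
  uvars ε []             = []
  uvars ε ((υ , t) ∷ l)  = var (υ , T-∧ˡ (isU υ) _ t , refl) ∷ uvars ε l

  eTerm : (q : Fin k) → Term Ωsk VU (sorts q)
  eTerm q = ifT (isU q) (λ u → var (q , u , refl))
                        (λ e → app (inj₂ (q , e , refl , refl)) (uvars q (Uε q)))

  e : ∀ {s} → VK {Ω} k sorts s → Term Ωsk VU s
  e (q , refl) = eTerm q

  ψMatrix : List (List (Literal Ωsk VU))
  ψMatrix = map (map (λ L → negLit (trSubstL inj₁ e L))) matrix

  _⊨ψ : {c ℓ : Level} → Structure Ωsk c ℓ → Set (c ⊔ ℓ)
  𝒜 ⊨ψ = SatUnivCNF 𝒜 ψMatrix

  reduct : {c ℓ : Level} → Structure Ωsk c ℓ → Structure Ω c ℓ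
  reduct 𝒜 = record
    { Car = Car 𝒜 ; fun = λ f → fun 𝒜 (inj₁ f)
    ; fun-cong = λ f → fun-cong 𝒜 (inj₁ f)
    ; rel = rel 𝒜 ; rel-resp = rel-resp 𝒜 }

  inU∃∪E : Fin k → Bool
  inU∃∪E q = isU∃ q ∨ isE q

  private
    lemU : ∀ a b → T a → T ((a ∧ b) ∨ not a) → T (a ∧ b)
    lemU true b _ t with b
    ... | true = tt
    lemU true b _ () | false

    lemU∀ : ∀ a b → T (not (a ∧ not b)) → T ((a ∧ b) ∨ not a)
    lemU∀ true  true  t = tt
    lemU∀ false b     t = T-∨ʳ (false ∧ b) true tt

  notU∀ : ∀ q → T (not (isU∀ q)) → T (inU∃∪E q)
  notU∀ q = lemU∀ (isU q) (inSomeUε q)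

  Uε⊆U∃ : ∀ ε υ → T (isE ε) → T (isU υ ∧ (υ <?ᵇ ε)) → T (isU∃ υ)
  Uε⊆U∃ ε υ tE t =
    T-∧ (isU υ) _ (T-∧ˡ (isU υ) _ t)
        (anyFin-intro k (λ ε' → isE ε' ∧ (υ <?ᵇ ε')) ε
           (T-∧ (isE ε) _ tE (T-∧ʳ (isU υ) _ t)))

  module _ {c ℓ : Level} (𝒜 : Structure Ωsk c ℓ) where

    argsα : (α : Env 𝒜 VU∃) (ε : Fin k) → T (isE ε) →
            (l : List (Σ (Fin k) λ υ → T (isU υ ∧ (υ <?ᵇ ε)))) →
            Args (Car 𝒜) (map (λ u → sorts (proj₁ u)) l)
    argsα α ε tE []            = []
    argsα α ε tE ((υ , t) ∷ l) = α (υ , Uε⊆U∃ ε υ tE t , refl) ∷ argsα α ε tE l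

    -- the value of e_q in 𝒜 under a valuation α of the x_q, q ∈ U_∃
    -- (for q ∈ U_∃ ∪ E all variables of e_q lie in U_∃)
    valE : (α : Env 𝒜 VU∃) (q : Fin k) → T (inU∃∪E q) → Carrier 𝒜 (sorts q)
    valE α q p =
      ifT (isU q) (λ u → α (q , lemU (isU q) (inSomeUε q) u p , refl))
                  (λ tE → fun 𝒜 (inj₂ (q , tE , refl , refl)) (argsα α q tE (Uε q)))

  -- a set of refutation witnesses Φ = {φ_α} built from 𝒜: for each
  -- valuation α of x_q (q ∈ U_∃) in 𝒜, ground Ω-terms e'_q (q ∈ U_∃ ∪ E)
  -- whose value in 𝒜 is the value of e_q under α
  record RefutationWitnesses {c ℓ : Level} (𝒜 : Structure Ωsk c ℓ) : Set (c ⊔ ℓ) where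
    field
      e'     : (α : Env 𝒜 VU∃) (q : Fin k) → T (inU∃∪E q) → GTerm Ω (sorts q)
      e'-val : ∀ (α : Env 𝒜 VU∃) q p →
               Setoid._≈_ (Car 𝒜 (sorts q)) (h (reduct 𝒜) (e' α q p)) (valE 𝒜 α q p)

    e'Subst : (α : Env 𝒜 VU∃) → ∀ {s} → VK {Ω} k sorts s → Term Ω VU∀ s
    e'Subst α (q , refl) =
      ifT (isU∀ q) (λ u → var (q , u , refl))
                   (λ nu → weaken (e' α q (notU∀ q nu)))

    φMatrix : Env 𝒜 VU∃ → List (List (Literal Ω VU∀))
    φMatrix α = map (map (λ L → negLit (substL (e'Subst α) L))) matrix

  _∈Matrix : Literal Ω (VK {Ω} k sorts) → Set
  L ∈Matrix = Any (L ∈_) matrix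

{-# OPTIONS --safe #-}
module Submission where

-- Fix α and a ground instance ρ of the U_∀-variables of φ_α.  Putting ρ on
-- U_∀ and the witnesses e'_q elsewhere gives one ground substitution σ of all
-- variables of φ, and under the valuation of ψ that is h ∘ ρ on U_∀ and α on
-- U_∃ every e_q takes the value h(σ x_q).  So a literal of ψ holds there in 𝒜
-- iff its σ-instance holds in 𝒜, and the matching literal of φ_α holds at ρ
-- in 𝓘 iff its σ-instance holds in 𝓘.  A positive σ-instance true in 𝓘 is
-- derivable, hence true in 𝒜; a negative one is reflected from 𝒜 to 𝓘 by
-- hypothesis.  Hence each clause of ψ satisfied in 𝒜 yields a clause of φ_α
-- satisfied in 𝓘.

open import Defs
open import Level using (Level; 0ℓ)
open import Function using (_∘_; _⇔_; mk⇔; Equivalence)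
open import Function.Construct.Composition using (_⇔-∘_)
open import Function.Construct.Symmetry using (⇔-sym)
open import Data.Bool using (true; false; T; not; _∧_)
open import Data.Bool.Properties using (T-irrelevant)
open import Data.Fin using (Fin)
open import Data.Product using (Σ; _,_)
open import Data.List using (List; []; _∷_; map)
open import Data.List.Relation.Unary.All as All using (All)
open import Data.List.Relation.Unary.Any as Any using (Any)
import Data.List.Relation.Unary.All.Properties as All
import Data.List.Relation.Unary.Any.Properties as Any
open import Data.List.Membership.Propositional using (_∈_; find; lose)
open import Data.Sum using (inj₁; inj₂)
open import Relation.Binary using (Setoid)
open import Relation.Binary.PropositionalEquality as ≡
  using (_≡_; refl; cong; cong₂; subst; subst₂; module ≡-Reasoning)

open Equivalence using (to; from)

ifT-true : ∀ {a} {A : Set a} b {f : T b → A} {g : T (not b) → A} (t : T b) →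
           ifT b f g ≡ f t
ifT-true true _ = refl

ifT-false : ∀ {a} {A : Set a} b {f : T b → A} {g : T (not b) → A} (t : T (not b)) →
            ifT b f g ≡ g t
ifT-false false _ = refl

ifT-elim : ∀ {a p} {A : Set a} (P : A → Set p) b {f : T b → A} {g : T (not b) → A} →
           (∀ t → P (f t)) → (∀ t → P (g t)) → P (ifT b f g)
ifT-elim P true  Pf Pg = Pf _
ifT-elim P false Pf Pg = Pg _

ifT-elim₂ : ∀ {a b p} {A : Set a} {B : Set b} (P : A → B → Set p) c
            {f : T c → A} {g : T (not c) → A} {f' : T c → B} {g' : T (not c) → B} →
            (∀ t → P (f t) (f' t)) → (∀ t → P (g t) (g' t)) →
            P (ifT c f g) (ifT c f' g')
ifT-elim₂ P true  Pf Pg = Pf _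
ifT-elim₂ P false Pf Pg = Pg _

All-Any-map-map : ∀ {a b c p q} {A : Set a} {B : Set b} {C : Set c}
                  {P : B → Set p} {Q : C → Set q} {f : A → B} {g : A → C}
                  (m : List (List A)) →
                  (∀ {x} → Any (x ∈_) m → P (f x) → Q (g x)) →
                  All (Any P) (map (map f) m) → All (Any Q) (map (map g) m)
All-Any-map-map {P = P} {Q} {f} {g} m transfer Pm =
  All.map⁺ (All.tabulate λ cl∈m → clause cl∈m (All.lookup (All.map⁻ Pm) cl∈m))
  where
  clause : ∀ {cl} → cl ∈ m → Any P (map f cl) → Any Q (map g cl)
  clause cl∈m Pcl with find (Any.map⁻ Pcl)
  ... | x , x∈cl , Pfx = Any.map⁺ (lose x∈cl (transfer (lose cl∈m x∈cl) Pfx))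

Args≈-sym : ∀ {c ℓ} {S : Set} {C : S → Setoid c ℓ} {ws} {xs ys : Args C ws} →
            Args≈ C xs ys → Args≈ C ys xs
Args≈-sym []                   = []
Args≈-sym {C = C} (x≈y ∷ xs≈ys) = Setoid.sym (C _) x≈y ∷ Args≈-sym xs≈ys

module _ {Ω : Signature} {F : List (Sort Ω) → Sort Ω → Set}
         (tr : ∀ {ws s} → Fun Ω ws s → F ws s)
         {c ℓ : Level} (M : Structure (withFun Ω F) c ℓ) where

  -- For tr = inj₁ this is Skolem.reduct, for tr = id it is M itself (both
  -- definitionally), so the lemmas below serve Skolem and plain substitution alike.
  reductAlong : Structure Ω c ℓ
  reductAlong = record
    { Car = Car M ; fun = λ f → fun M (tr f) ; fun-cong = λ f → fun-cong M (tr f)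
    ; rel = rel M ; rel-resp = rel-resp M }

  module _ {V V' : Sort Ω → Set} (τ : ∀ {s} → V s → Term (withFun Ω F) V' s)
           {ρ : Env M V'} {ρ' : Env reductAlong V}
           (τρ≈ρ' : ∀ {s} (x : V s) → Setoid._≈_ (Car M s) (eval M (τ x) ρ) (ρ' x))
           where

    mutual
      eval-trSubst : ∀ {s} (t : Term Ω V s) →
                     Setoid._≈_ (Car M s) (eval M (trSubst tr τ t) ρ) (eval reductAlong t ρ')
      eval-trSubst (var x)    = τρ≈ρ' x
      eval-trSubst (app f ts) = fun-cong M (tr f) (evals-trSubsts ts)

      evals-trSubsts : ∀ {ws} (ts : Terms Ω V ws) →
                       Args≈ (Car M) (evals M (trSubsts tr τ ts) ρ) (evals reductAlong ts ρ')
      evals-trSubsts []       = []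
      evals-trSubsts (t ∷ ts) = eval-trSubst t ∷ evals-trSubsts ts

    satA-trSubstA : (a : Atom Ω V) → satA M (trSubstA tr τ a) ρ ⇔ satA reductAlong a ρ'
    satA-trSubstA (pr P ts) =
      mk⇔ (rel-resp M P (evals-trSubsts ts)) (rel-resp M P (Args≈-sym (evals-trSubsts ts)))
    satA-trSubstA (_≐_ {s} t u) =
      mk⇔ (λ t≈u → trans (sym (eval-trSubst t)) (trans t≈u (eval-trSubst u)))
          (λ t≈u → trans (eval-trSubst t) (trans t≈u (sym (eval-trSubst u))))
      where open Setoid (Car M s) using (sym; trans)

eval-weaken : ∀ {Ω c ℓ} (M : Structure Ω c ℓ) {V s} (t : GTerm Ω s) {ρ : Env M V} →
              Setoid._≈_ (Car M s) (eval M (weaken t) ρ) (h M t)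
eval-weaken M t = eval-trSubst (λ f → f) M _ (λ ()) t

module _ {Ω : Signature} (𝒮 : Theory Ω) where
  open Initial 𝒮

  mutual
    h-𝓘 : ∀ {s} (t : GTerm Ω s) → h 𝓘 t ≡ t
    h-𝓘 (var ())
    h-𝓘 (app f ts) = cong (app f) (hs-𝓘 ts)

    hs-𝓘 : ∀ {ws} (ts : Terms Ω Ø ws) → toTerms (evals 𝓘 ts (emptyEnv 𝓘)) ≡ ts
    hs-𝓘 []       = refl
    hs-𝓘 (t ∷ ts) = cong₂ _∷_ (h-𝓘 t) (hs-𝓘 ts)

  satGA-𝓘⇒Derives : (a : Atom Ω Ø) → satGA 𝓘 a → Derives a
  satGA-𝓘⇒Derives (pr P ts) = subst (Derives ∘ pr P) (hs-𝓘 ts)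
  satGA-𝓘⇒Derives (t ≐ u)   = subst₂ (λ t u → Derives (t ≐ u)) (h-𝓘 t) (h-𝓘 u)

module _ {Ω : Signature} (φ : PrenexDNF Ω) where
  open PrenexDNF φ
  open Skolem φ

  U∀⊆U : ∀ q → T (isU∀ q) → T (isU q)
  U∀⊆U q = T-∧ˡ (isU q) _

  U∃⇒¬U∀ : ∀ q → T (isU∃ q) → T (not (isU∀ q))
  U∃⇒¬U∀ q = bool (isU q) (inSomeUε q)
    where
    bool : ∀ a b → T (a ∧ b) → T (not (a ∧ not b))
    bool true  true  _ = _
    bool true  false ()
    bool false _     ()

  U∖U∀⊆U∃ : ∀ q → T (isU q) → T (not (isU∀ q)) → T (isU∃ q)
  U∖U∀⊆U∃ q = bool (isU q) (inSomeUε q)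
    where
    bool : ∀ a b → T a → T (not (a ∧ not b)) → T (a ∧ b)
    bool true true  _ _ = _
    bool true false _ ()

  module _ {c ℓ : Level} (𝒜 : Structure Ωsk c ℓ) (α : Env 𝒜 VU∃) {ρ : Env 𝒜 VU}
           (ρ≡α : ∀ q (u : T (isU q)) (u∃ : T (isU∃ q)) →
                  ρ (q , u , refl) ≡ α (q , u∃ , refl)) where

    evals-uvars : ∀ ε (e : T (isE ε)) l → evals 𝒜 (uvars ε l) ρ ≡ argsα 𝒜 α ε e l
    evals-uvars ε e []            = refl
    evals-uvars ε e ((υ , _) ∷ l) = cong₂ _∷_ (ρ≡α υ _ _) (evals-uvars ε e l)

    eval-eTerm : ∀ q (p : T (inU∃∪E q)) → eval 𝒜 (eTerm q) ρ ≡ valE 𝒜 α q p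
    eval-eTerm q p =
      ifT-elim₂ (λ t v → eval 𝒜 t ρ ≡ v) (isU q)
        (λ u → ρ≡α q u _)
        (λ e → cong (fun 𝒜 (inj₂ (q , e , refl , refl))) (evals-uvars q e (Uε q)))

module Refutation {Ω : Signature} (𝒮 : Theory Ω) (φ : PrenexDNF Ω)
                  {𝒜 : Structure (Skolem.Ωsk φ) 0ℓ 0ℓ}
                  (Φ : Skolem.RefutationWitnesses φ 𝒜) (α : Env 𝒜 (Skolem.VU∃ φ))
                  (ρ : Env (Initial.𝓘 𝒮) (Skolem.VU∀ φ)) where
  open PrenexDNF φ
  open Skolem φ
  open Skolem.RefutationWitnesses Φ
  open Initial 𝒮

  R : Structure Ω 0ℓ 0ℓ
  R = reduct 𝒜

  σ : ∀ {s} → VK {Ω} k sorts s → GTerm Ω s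
  σ (q , refl) =
    ifT (isU∀ q) (λ u∀ → ρ (q , u∀ , refl)) (λ ¬u∀ → e' α q (notU∀ q ¬u∀))

  ρ𝒜 : Env 𝒜 VU
  ρ𝒜 (q , u , refl) =
    ifT (isU∀ q) (λ u∀ → h R (ρ (q , u∀ , refl)))
                 (λ ¬u∀ → α (q , U∖U∀⊆U∃ φ q u ¬u∀ , refl))

  ρ𝒜≡α : ∀ q (u : T (isU q)) (u∃ : T (isU∃ q)) →
         ρ𝒜 (q , u , refl) ≡ α (q , u∃ , refl)
  ρ𝒜≡α q u u∃ = ≡.trans (ifT-false (isU∀ q) (U∃⇒¬U∀ φ q u∃))
                         (cong (λ v → α (q , v , refl)) (T-irrelevant _ _))

  eval-e≈hσ : ∀ {s} (x : VK {Ω} k sorts s) →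
              Setoid._≈_ (Car 𝒜 s) (eval 𝒜 (e x) ρ𝒜) (h R (σ x))
  eval-e≈hσ (q , refl) =
    ifT-elim (λ t → eval 𝒜 (eTerm q) ρ𝒜 ≈ h R t) (isU∀ q)
      (reflexive ∘ eval-eTerm-U∀)
      (λ ¬u∀ → ≈-trans (reflexive (eval-eTerm φ 𝒜 α ρ𝒜≡α q _)) (≈-sym (e'-val α q _)))
    where
    open Setoid (Car 𝒜 (sorts q))
      using (_≈_; reflexive) renaming (trans to ≈-trans; sym to ≈-sym)
    open ≡-Reasoning

    eval-eTerm-U∀ : (u∀ : T (isU∀ q)) → eval 𝒜 (eTerm q) ρ𝒜 ≡ h R (ρ (q , u∀ , refl))
    eval-eTerm-U∀ u∀ = begin
      eval 𝒜 (eTerm q) ρ𝒜      ≡⟨ cong (λ t → eval 𝒜 t ρ𝒜) (ifT-true (isU q) u) ⟩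
      ρ𝒜 (q , u , refl)        ≡⟨ ifT-true (isU∀ q) u∀ ⟩
      h R (ρ (q , u∀ , refl))  ∎
      where u = U∀⊆U φ q u∀

  eval-e'≈σ : ∀ {s} (x : VK {Ω} k sorts s) →
              Setoid._≈_ (Car 𝓘 s) (eval 𝓘 (e'Subst α x) ρ) (σ x)
  eval-e'≈σ (q , refl) =
    ifT-elim₂ (λ t g → eval 𝓘 t ρ ≈ g) (isU∀ q)
      (λ u∀ → ≈-refl {ρ (q , u∀ , refl)})
      (λ ¬u∀ → let g = e' α q (notU∀ q ¬u∀) in
        ≈-trans {eval 𝓘 (weaken g) ρ} {h 𝓘 g} {g}
                (eval-weaken 𝓘 g) (reflexive (h-𝓘 𝒮 g)))
    where
    open Setoid (Car 𝓘 (sorts q))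
      using (_≈_; reflexive) renaming (refl to ≈-refl; trans to ≈-trans)

  ψ-atom⇔σ-atom : (a : Atom Ω (VK {Ω} k sorts)) →
                  satA 𝒜 (trSubstA inj₁ e a) ρ𝒜 ⇔ satGA R (substA σ a)
  ψ-atom⇔σ-atom a =
    ⇔-sym (satA-trSubstA (λ f → f) R σ (λ _ → Setoid.refl (Car 𝒜 _)) a)
      ⇔-∘ satA-trSubstA inj₁ 𝒜 e eval-e≈hσ a

  φα-atom⇔σ-atom : (a : Atom Ω (VK {Ω} k sorts)) →
                   satA 𝓘 (substA (e'Subst α) a) ρ ⇔ satGA 𝓘 (substA σ a)
  φα-atom⇔σ-atom a =
    ⇔-sym (satA-trSubstA (λ f → f) 𝓘 σ {emptyEnv 𝓘} {σ}
             (λ x → Setoid.reflexive (Car 𝓘 _) (h-𝓘 𝒮 (σ x))) a)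
      ⇔-∘ satA-trSubstA (λ f → f) 𝓘 (e'Subst α) {ρ} {σ} eval-e'≈σ a

  NegativeLiteralsReflected : Set₁
  NegativeLiteralsReflected =
    (a : Atom Ω (VK {Ω} k sorts)) → neg a ∈Matrix →
    (τ : ∀ {s} → VK {Ω} k sorts s → GTerm Ω s) →
    satGA R (substA τ a) → satGA 𝓘 (substA τ a)

  ψ-literal⇒φα-literal : IsModel R 𝒮 → NegativeLiteralsReflected → ∀ {L} → L ∈Matrix →
                         satL 𝒜 (negLit (trSubstL inj₁ e L)) ρ𝒜 →
                         satL 𝓘 (negLit (substL (e'Subst α) L)) ρ
  ψ-literal⇒φα-literal model reflect {pos a} _ ¬𝒜⊨a 𝓘⊨a =
    ¬𝒜⊨a (from (ψ-atom⇔σ-atom a)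
      (satGA-𝓘⇒Derives 𝒮 (substA σ a) (to (φα-atom⇔σ-atom a) 𝓘⊨a) R model))
  ψ-literal⇒φα-literal model reflect {neg a} ¬a∈φ 𝒜⊨a =
    from (φα-atom⇔σ-atom a) (reflect a ¬a∈φ σ (to (ψ-atom⇔σ-atom a) 𝒜⊨a))

proposition5 :
    (Ω : Signature) (𝒮 : Theory Ω) (φ : PrenexDNF Ω)
    (𝒜 : Structure (Skolem.Ωsk φ) 0ℓ 0ℓ) →
    -- 𝒜 ⊨ ψ
    Skolem._⊨ψ φ 𝒜 →
    -- the Ω-reduct of 𝒜 is a model of 𝒮
    IsModel (Skolem.reduct φ 𝒜) 𝒮 →
    -- every element of 𝒜_{s_q}, q ∈ U_∃ ∪ E, is the value of a ground Ω-term
    ((q : Fin (PrenexDNF.k φ)) → T (Skolem.inU∃∪E φ q) →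
       (a : Carrier 𝒜 (PrenexDNF.sorts φ q)) →
       Σ (GTerm Ω (PrenexDNF.sorts φ q))
         (λ t → Setoid._≈_ (Car 𝒜 (PrenexDNF.sorts φ q)) (h (Skolem.reduct φ 𝒜) t) a)) →
    -- negative literals ¬A of φ: h(σA) true in 𝒜 implies 𝒮 ⊢ σA
    ((a : Atom Ω (VK {Ω} (PrenexDNF.k φ) (PrenexDNF.sorts φ))) →
       Skolem._∈Matrix φ (neg a) →
       (σ : ∀ {s} → VK {Ω} (PrenexDNF.k φ) (PrenexDNF.sorts φ) s → GTerm Ω s) →
       satGA (Skolem.reduct φ 𝒜) (substA σ a) →
       satGA (Initial.𝓘 𝒮) (substA σ a)) →
    -- for any set of refutation witnesses Φ = {φ_α}, 𝓘 ⊨ φ_α for all α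
    (Φ : Skolem.RefutationWitnesses φ 𝒜) →
    (α : Env 𝒜 (Skolem.VU∃ φ)) →
    SatUnivCNF (Initial.𝓘 𝒮) (Skolem.RefutationWitnesses.φMatrix Φ α)
-- Term-surjectivity only guarantees that some Φ exists.
proposition5 Ω 𝒮 φ 𝒜 𝒜⊨ψ model _ reflect Φ α ρ =
  All-Any-map-map (PrenexDNF.matrix φ) (ψ-literal⇒φα-literal model reflect) (𝒜⊨ψ ρ𝒜)
  where open Refutation 𝒮 φ Φ α ρ
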